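{- Let $(x,y,k)$ be a good triplet. Then there exist $p,q \in \mathbb{N}$ such that $$0 < C(q,p,x,y) < 3q x^{1/6} + 1,$$ and moreover $q < x^{1/6}$ and $p < x^{2/3}+1$.
   Context: Here $\mathbb{N}=\{1,2,3,\dots\}$. A triple $(x,y,k)$ is a good triplet if $x,y \in \mathbb{N}$, $k = x^3 - y^2 \in \mathbb{Z}$, and $0 < |k| < \sqrt{x}$. The polynomial $C$ is $C(q,p,x,y) = p^3 - 3pq^2x + 2q^3y$. -}

module Defs where

open import Data.Nat using (ℕ)
open import Data.Integer using (ℤ; +_; _+_; _-_; _*_; _^_; _<_; ∣_∣)
open import Data.Product using (_×_)
open import Relation.Binary.PropositionalEquality using (_≡_)
open import Relation.Nullary using (¬_)

-- Good triplet (x,y,k): x,y ∈ ℕ = {1,2,...}, k = x³ − y², 0 < |k| < √x.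
-- Since x > 0, the condition 0 < |k| < √x is equivalent (exactly) to
-- k ≠ 0 and k² < x (both sides nonnegative, squaring is monotone).
GoodTriplet : ℤ → ℤ → ℤ → Set
GoodTriplet x y k =
  (+ 0 < x) × (+ 0 < y) × (k ≡ x ^ 3 - y ^ 2) × ¬ (k ≡ + 0) × (k ^ 2 < x)

C : ℤ → ℤ → ℤ → ℤ → ℤ
C q p x y = p ^ 3 - + 3 * p * q ^ 2 * x + + 2 * q ^ 3 * y

module Submission where

-- For large x, take m with m⁶ < x ≤ (m + 1)⁶ and, by Dirichlet's approximation theorem,
-- 1 ≤ q ≤ m and p with ∣px − qy∣ (m + 1) ≤ x. With u = px − qy and k = x³ − y² one has
--   x³ C(q, p, x, y) = 3yqu² + (u³ − 3kq²u − kyq³),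
-- where the bracket is less than x³/2 in absolute value since ∣u∣ ≤ x/(m + 1), q⁶ < x and k² < x.
-- If k < 0, the term −kyq³ > 0 dominates u³ − 3kq²u, so C > 0. If k > 0 and C ≤ 0, then 3yqu²
-- is dominated by the bracket, which forces 2u² ≤ kq² and so 0 < u² + kq² < x; impossible, as
-- u² + kq² is a multiple of x. The same identity bounds C from above, and px = qy + u bounds p.
-- For x < 64 the only good triplet is (2, 3, −1), found by exhaustive search.

open import Defs using (GoodTriplet; C)

module Construction where

  open import Data.Nat
  open import Data.Nat.Properties
  open import Data.Nat.DivMod
  open import Data.Nat.Divisibility using (divides; ∣⇒≤)
  open import Data.Nat.Solver using (module +-*-Solver)
  open import Data.Fin using (Fin; toℕ; fromℕ<)
  open import Data.Fin.Properties using (pigeonhole; toℕ<n; toℕ-fromℕ<)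
  open import Data.List using (upTo)
  open import Data.List.Relation.Unary.All as All using (All; all?)
  open import Data.List.Membership.Propositional.Properties using (∈-upTo⁺)
  open import Data.Product using (∃; ∃₂; _×_; _,_; proj₁; proj₂)
  open import Data.Sum using (_⊎_; inj₁; inj₂; [_,_]′)
  open import Data.Empty using (⊥-elim)
  open import Function using (_∘_)
  open import Relation.Binary.PropositionalEquality
  open import Relation.Nullary using (¬_; Dec; yes; no)
  open import Relation.Nullary.Decidable using (toWitness; _×-dec_; _→-dec_; ¬?)

  module ℤ where
    open import Data.Integer.Base public
    open import Data.Integer.Properties public
    open import Data.Integer.Solver public using (module +-*-Solver)
  open ℤ using (ℤ; +_; -[1+_]; _⊖_)

  module Estimates where
    open +-*-Solver
    open ≤-Reasoning

    ^-cancelˡ-< : ∀ n {m o} → m ^ n < o ^ n → m < o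
    ^-cancelˡ-< n mⁿ<oⁿ = ≰⇒> λ o≤m → <⇒≱ mⁿ<oⁿ (^-monoˡ-≤ n o≤m)

    x³≤y²+k⇒7x<y : ∀ x y k → 50 ≤ x → k < x → x ^ 3 ≤ y ^ 2 + k → 7 * x < y
    x³≤y²+k⇒7x<y x y k 50≤x k<x x³≤y²+k = ≰⇒> λ y≤7x → <-irrefl refl (begin-strict
      x ^ 3               ≤⟨ x³≤y²+k ⟩
      y ^ 2 + k           <⟨ +-mono-≤-< (^-monoˡ-≤ 2 y≤7x) k<x ⟩
      (7 * x) ^ 2 + x     ≤⟨ +-monoʳ-≤ ((7 * x) ^ 2) (m≤m*n x x {{>-nonZero (<-≤-trans z<s 50≤x)}}) ⟩
      (7 * x) ^ 2 + x * x ≡⟨ solve 1 (λ x → (con 7 :* x) :^ 2 :+ x :* x := con 50 :* (x :* x)) refl x ⟩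
      50 * (x * x)        ≤⟨ *-monoˡ-≤ (x * x) 50≤x ⟩
      x * (x * x)         ≡⟨ solve 1 (λ x → x :* (x :* x) := x :^ 3) refl x ⟩
      x ^ 3               ∎)

    3kq²<2x : ∀ x k q → 12 ≤ x → k ^ 2 < x → q ^ 6 < x → 3 * k * q ^ 2 < 2 * x
    3kq²<2x x k q 12≤x k²<x q⁶<x = ^-cancelˡ-< 6 (begin-strict
      (3 * k * q ^ 2) ^ 6               ≡⟨ solve 2 (λ k q → (con 3 :* k :* q :^ 2) :^ 6 := con 729 :* ((k :^ 2) :^ 3 :* (q :^ 6) :^ 2)) refl k q ⟩
      729 * ((k ^ 2) ^ 3 * (q ^ 6) ^ 2) <⟨ *-monoʳ-< 729 (*-mono-< (^-monoˡ-< 3 k²<x) (^-monoˡ-< 2 q⁶<x)) ⟩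
      729 * (x ^ 3 * x ^ 2)             ≤⟨ *-monoˡ-≤ (x ^ 3 * x ^ 2) (≤-trans (≤ᵇ⇒≤ 729 768 _) (*-monoʳ-≤ 64 12≤x)) ⟩
      64 * x * (x ^ 3 * x ^ 2)          ≡⟨ solve 1 (λ x → con 64 :* x :* (x :^ 3 :* x :^ 2) := (con 2 :* x) :^ 6) refl x ⟩
      (2 * x) ^ 6                       ∎)

    y²≤x³+x⇒y⁶≤x⁹+4x⁷ : ∀ x y → 2 ≤ x → y ^ 2 ≤ x ^ 3 + x → (y ^ 2) ^ 3 ≤ x ^ 9 + 4 * x ^ 7
    y²≤x³+x⇒y⁶≤x⁹+4x⁷ x y 2≤x y²≤x³+x = begin
      (y ^ 2) ^ 3                             ≤⟨ ^-monoˡ-≤ 3 y²≤x³+x ⟩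
      (x ^ 3 + x) ^ 3                         ≡⟨ solve 1 (λ x → (x :^ 3 :+ x) :^ 3 := x :^ 9 :+ con 3 :* x :^ 7 :+ (con 3 :* x :^ 5 :+ x :^ 3)) refl x ⟩
      x ^ 9 + 3 * x ^ 7 + (3 * x ^ 5 + x ^ 3) ≤⟨ +-monoʳ-≤ (x ^ 9 + 3 * x ^ 7) lower-terms ⟩
      x ^ 9 + 3 * x ^ 7 + x ^ 7               ≡⟨ solve 1 (λ x → x :^ 9 :+ con 3 :* x :^ 7 :+ x :^ 7 := x :^ 9 :+ con 4 :* x :^ 7) refl x ⟩
      x ^ 9 + 4 * x ^ 7                       ∎
      where
      instance
        x≢0 : NonZero x
        x≢0 = >-nonZero (<-≤-trans z<s 2≤x)
      lower-terms : 3 * x ^ 5 + x ^ 3 ≤ x ^ 7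
      lower-terms = begin
        3 * x ^ 5 + x ^ 3 ≤⟨ +-monoʳ-≤ (3 * x ^ 5) (^-monoʳ-≤ x (≤ᵇ⇒≤ 3 5 _)) ⟩
        3 * x ^ 5 + x ^ 5 ≡⟨ solve 1 (λ x → con 3 :* x :^ 5 :+ x :^ 5 := con 2 :* con 2 :* x :^ 5) refl x ⟩
        2 * 2 * x ^ 5     ≤⟨ *-monoˡ-≤ (x ^ 5) (*-mono-≤ 2≤x 2≤x) ⟩
        x * x * x ^ 5     ≡⟨ solve 1 (λ x → x :* x :* x :^ 5 := x :^ 7) refl x ⟩
        x ^ 7             ∎

    px<qy⇒p³<x² : ∀ x y q p → 64 ≤ x → q ^ 6 < x → y ^ 2 ≤ x ^ 3 + x → p * x < q * y → p ^ 3 < x ^ 2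
    px<qy⇒p³<x² x y q p 64≤x q⁶<x y²≤x³+x px<qy = ^-cancelˡ-< 2 (begin-strict
      (p ^ 3) ^ 2 ≡⟨ solve 1 (λ p → (p :^ 3) :^ 2 := p :^ 6) refl p ⟩
      p ^ 6       <⟨ *-cancelʳ-< (x ^ 6) _ _ p⁶x⁶<x⁴x⁶ ⟩
      x ^ 4       ≡⟨ solve 1 (λ x → x :^ 4 := (x :^ 2) :^ 2) refl x ⟩
      (x ^ 2) ^ 2 ∎)
      where
      w : ℕ
      w = q ^ 6
      p⁶x⁶<x⁴x⁶ : p ^ 6 * x ^ 6 < x ^ 4 * x ^ 6
      p⁶x⁶<x⁴x⁶ = begin-strict
        p ^ 6 * x ^ 6               ≡⟨ solve 2 (λ p x → p :^ 6 :* x :^ 6 := (p :* x) :^ 6) refl p x ⟩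
        (p * x) ^ 6                 <⟨ ^-monoˡ-< 6 px<qy ⟩
        (q * y) ^ 6                 ≡⟨ solve 2 (λ q y → (q :* y) :^ 6 := q :^ 6 :* (y :^ 2) :^ 3) refl q y ⟩
        w * (y ^ 2) ^ 3             ≤⟨ *-monoʳ-≤ w (y²≤x³+x⇒y⁶≤x⁹+4x⁷ x y (≤-trans (≤ᵇ⇒≤ 2 64 _) 64≤x) y²≤x³+x) ⟩
        w * (x ^ 9 + 4 * x ^ 7)     ≡⟨ solve 2 (λ w x → w :* (x :^ 9 :+ con 4 :* x :^ 7) := w :* x :^ 9 :+ con 4 :* w :* x :^ 7) refl w x ⟩
        w * x ^ 9 + 4 * w * x ^ 7   ≤⟨ +-monoʳ-≤ (w * x ^ 9) (*-monoˡ-≤ (x ^ 7) (*-monoʳ-≤ 4 (<⇒≤ q⁶<x))) ⟩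
        w * x ^ 9 + 4 * x * x ^ 7   ≡⟨ solve 2 (λ w x → w :* x :^ 9 :+ con 4 :* x :* x :^ 7 := w :* x :^ 9 :+ con 4 :* x :^ 8) refl w x ⟩
        w * x ^ 9 + 4 * x ^ 8       ≤⟨ +-monoʳ-≤ (w * x ^ 9) (*-monoˡ-≤ (x ^ 8) (≤-trans (≤ᵇ⇒≤ 4 64 _) 64≤x)) ⟩
        w * x ^ 9 + x * x ^ 8       ≡⟨ solve 2 (λ w x → w :* x :^ 9 :+ x :* x :^ 8 := (con 1 :+ w) :* x :^ 9) refl w x ⟩
        (1 + w) * x ^ 9             ≤⟨ *-monoˡ-≤ (x ^ 9) q⁶<x ⟩
        x * x ^ 9                   ≡⟨ solve 1 (λ x → x :* x :^ 9 := x :^ 4 :* x :^ 6) refl x ⟩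
        x ^ 4 * x ^ 6               ∎
      instance
        x⁶≢0 : NonZero (x ^ 6)
        x⁶≢0 = m^n≢0 x 6 {{>-nonZero (<-≤-trans z<s 64≤x)}}

    -- For a = ∣u∣ and k = ∣x³ − y²∣, a bound on ∣u³ − 3kq²u − kyq³∣ (see C-expansion).
    remainderBound : ℕ → ℕ → ℕ → ℕ → ℕ
    remainderBound y k q a = a ^ 3 + 3 * k * q ^ 2 * a + k * (y * q ^ 3)

    2*remainderBound<x³ : ∀ x y k q a → 64 ≤ x → k ^ 2 < x → q ^ 6 < x → y ^ 2 ≤ x ^ 3 + x →
                          2 * a ≤ x → 3 * k * q ^ 2 < 2 * x → 2 * remainderBound y k q a < x ^ 3
    2*remainderBound<x³ x y k q a 64≤x k²<x q⁶<x y²≤x³+x 2a≤x 3kq²<2x = *-cancelˡ-< 32 _ _ (begin-strict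
      32 * (2 * remainderBound y k q a)
        ≡⟨ solve 4 (λ y k q a → con 32 :* (con 2 :* (a :^ 3 :+ con 3 :* k :* q :^ 2 :* a :+ k :* (y :* q :^ 3)))
                            := con 8 :* (con 8 :* a :^ 3) :+ con 32 :* ((con 3 :* k :* q :^ 2) :* (con 2 :* a))
                               :+ con 16 :* (con 4 :* (k :* (y :* q :^ 3)))) refl y k q a ⟩
      8 * (8 * a ^ 3) + 32 * ((3 * k * q ^ 2) * (2 * a)) + 16 * (4 * (k * (y * q ^ 3)))
        <⟨ +-mono-≤-< (+-mono-≤ (*-monoʳ-≤ 8 8a³≤x³) (*-monoʳ-≤ 32 (*-mono-≤ (<⇒≤ 3kq²<2x) 2a≤x)))
                      (*-monoʳ-< 16 4kyq³<x³) ⟩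
      8 * x ^ 3 + 32 * (2 * x * x) + 16 * x ^ 3
        ≤⟨ +-monoˡ-≤ (16 * x ^ 3) (+-monoʳ-≤ (8 * x ^ 3) 64x²≤x³) ⟩
      8 * x ^ 3 + x ^ 3 + 16 * x ^ 3
        ≡⟨ solve 1 (λ x → con 8 :* x :^ 3 :+ x :^ 3 :+ con 16 :* x :^ 3 := con 25 :* x :^ 3) refl x ⟩
      25 * x ^ 3
        ≤⟨ *-monoˡ-≤ (x ^ 3) (≤ᵇ⇒≤ 25 32 _) ⟩
      32 * x ^ 3 ∎)
      where
      instance
        x≢0 : NonZero x
        x≢0 = >-nonZero (<-≤-trans z<s 64≤x)
      8a³≤x³ : 8 * a ^ 3 ≤ x ^ 3
      8a³≤x³ = begin
        8 * a ^ 3   ≡⟨ solve 1 (λ a → con 8 :* a :^ 3 := (con 2 :* a) :^ 3) refl a ⟩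
        (2 * a) ^ 3 ≤⟨ ^-monoˡ-≤ 3 2a≤x ⟩
        x ^ 3       ∎
      64x²≤x³ : 32 * (2 * x * x) ≤ x ^ 3
      64x²≤x³ = begin
        32 * (2 * x * x) ≡⟨ solve 1 (λ x → con 32 :* (con 2 :* x :* x) := con 64 :* (x :* x)) refl x ⟩
        64 * (x * x)     ≤⟨ *-monoˡ-≤ (x * x) 64≤x ⟩
        x * (x * x)      ≡⟨ solve 1 (λ x → x :* (x :* x) := x :^ 3) refl x ⟩
        x ^ 3            ∎
      4kyq³<x³ : 4 * (k * (y * q ^ 3)) < x ^ 3
      4kyq³<x³ = ^-cancelˡ-< 2 (begin-strict
        (4 * (k * (y * q ^ 3))) ^ 2
          ≡⟨ solve 3 (λ y k q → (con 4 :* (k :* (y :* q :^ 3))) :^ 2 := con 16 :* (k :^ 2 :* (y :^ 2 :* q :^ 6))) refl y k q ⟩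
        16 * (k ^ 2 * (y ^ 2 * q ^ 6))
          ≤⟨ *-monoʳ-≤ 16 (*-mono-≤ (<⇒≤ k²<x) (*-mono-≤ y²≤x³+x (<⇒≤ q⁶<x))) ⟩
        16 * (x * ((x ^ 3 + x) * x))
          ≡⟨ solve 1 (λ x → con 16 :* (x :* ((x :^ 3 :+ x) :* x)) := con 16 :* x :^ 5 :+ con 16 :* x :^ 3) refl x ⟩
        16 * x ^ 5 + 16 * x ^ 3
          <⟨ +-monoʳ-< (16 * x ^ 5) (*-monoˡ-< (x ^ 3) {{m^n≢0 x 3}} (n<1+n 16)) ⟩
        16 * x ^ 5 + 17 * x ^ 3
          ≤⟨ +-monoʳ-≤ (16 * x ^ 5) (*-monoˡ-≤ (x ^ 3) (≤-trans (≤ᵇ⇒≤ 17 4096 _) (*-mono-≤ 64≤x 64≤x))) ⟩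
        16 * x ^ 5 + x * x * x ^ 3
          ≡⟨ solve 1 (λ x → con 16 :* x :^ 5 :+ x :* x :* x :^ 3 := con 17 :* x :^ 5) refl x ⟩
        17 * x ^ 5
          ≤⟨ *-monoˡ-≤ (x ^ 5) (≤-trans (≤ᵇ⇒≤ 17 64 _) 64≤x) ⟩
        x * x ^ 5
          ≡⟨ solve 1 (λ x → x :* x :^ 5 := (x :^ 3) :^ 2) refl x ⟩
        (x ^ 3) ^ 2 ∎)

    a³+3kq²a<3yqa²+kyq³ : ∀ y k q a → 1 ≤ k → 1 ≤ q → 3 * a < y * q →
                           a ^ 3 + 3 * k * q ^ 2 * a < 3 * y * q * a ^ 2 + k * (y * q ^ 3)
    a³+3kq²a<3yqa²+kyq³ y k q a 1≤k 1≤q 3a<yq = +-mono-≤-< a³≤3yqa² 3kq²a<kyq³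
      where
      a³≤3yqa² : a ^ 3 ≤ 3 * y * q * a ^ 2
      a³≤3yqa² = begin
        a ^ 3               ≡⟨ solve 1 (λ a → a :^ 3 := a :* a :^ 2) refl a ⟩
        a * a ^ 2           ≤⟨ *-monoˡ-≤ (a ^ 2) (≤-trans (m≤n*m a 3) (≤-trans (<⇒≤ 3a<yq) (m≤n*m (y * q) 3))) ⟩
        3 * (y * q) * a ^ 2 ≡⟨ solve 3 (λ y q a → con 3 :* (y :* q) :* a :^ 2 := con 3 :* y :* q :* a :^ 2) refl y q a ⟩
        3 * y * q * a ^ 2   ∎
      3kq²a<kyq³ : 3 * k * q ^ 2 * a < k * (y * q ^ 3)
      3kq²a<kyq³ = begin-strict
        3 * k * q ^ 2 * a   ≡⟨ solve 3 (λ k q a → con 3 :* k :* q :^ 2 :* a := k :* q :^ 2 :* (con 3 :* a)) refl k q a ⟩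
        k * q ^ 2 * (3 * a) <⟨ *-monoʳ-< (k * q ^ 2) {{>-nonZero (*-mono-≤ 1≤k (^-monoˡ-≤ 2 1≤q))}} 3a<yq ⟩
        k * q ^ 2 * (y * q) ≡⟨ solve 3 (λ y k q → k :* q :^ 2 :* (y :* q) := k :* (y :* q :^ 3)) refl y k q ⟩
        k * (y * q ^ 3)     ∎

    3yqa²≤remainderBound⇒a²+kq²<x : ∀ x y k q a → 1 ≤ y * q → 7 * a ≤ y * q → 3 * k * q ^ 2 < 2 * x →
                                    3 * y * q * a ^ 2 ≤ remainderBound y k q a → a ^ 2 + k * q ^ 2 < x
    3yqa²≤remainderBound⇒a²+kq²<x x y k q a 1≤yq 7a≤yq 3kq²<2x 3yqa²≤R = *-cancelˡ-< 2 _ _ (begin-strict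
      2 * (a ^ 2 + k * q ^ 2)     ≡⟨ solve 3 (λ k q a → con 2 :* (a :^ 2 :+ k :* q :^ 2) := con 2 :* a :^ 2 :+ con 2 :* (k :* q :^ 2)) refl k q a ⟩
      2 * a ^ 2 + 2 * (k * q ^ 2) ≤⟨ +-monoˡ-≤ (2 * (k * q ^ 2)) 2a²≤kq² ⟩
      k * q ^ 2 + 2 * (k * q ^ 2) ≡⟨ solve 2 (λ k q → k :* q :^ 2 :+ con 2 :* (k :* q :^ 2) := con 3 :* k :* q :^ 2) refl k q ⟩
      3 * k * q ^ 2               <⟨ 3kq²<2x ⟩
      2 * x                       ∎)
      where
      -- multiply by 7, then use 7a ≤ yq on the two terms of the bound that contain a
      2a²≤kq² : 2 * a ^ 2 ≤ k * q ^ 2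
      2a²≤kq² = *-cancelʳ-≤ _ _ (10 * (y * q)) {{>-nonZero (*-mono-≤ (≤ᵇ⇒≤ 1 10 _) 1≤yq)}}
        (+-cancelˡ-≤ (y * q * a ^ 2) _ _ (begin
          y * q * a ^ 2 + 2 * a ^ 2 * (10 * (y * q))
            ≡⟨ solve 3 (λ y q a → y :* q :* a :^ 2 :+ con 2 :* a :^ 2 :* (con 10 :* (y :* q)) := con 7 :* (con 3 :* y :* q :* a :^ 2)) refl y q a ⟩
          7 * (3 * y * q * a ^ 2)
            ≤⟨ *-monoʳ-≤ 7 3yqa²≤R ⟩
          7 * remainderBound y k q a
            ≡⟨ solve 4 (λ y k q a → con 7 :* (a :^ 3 :+ con 3 :* k :* q :^ 2 :* a :+ k :* (y :* q :^ 3))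
                                := (con 7 :* a) :* a :^ 2 :+ con 3 :* k :* q :^ 2 :* (con 7 :* a) :+ con 7 :* (k :* q :^ 2) :* (y :* q)) refl y k q a ⟩
          (7 * a) * a ^ 2 + 3 * k * q ^ 2 * (7 * a) + 7 * (k * q ^ 2) * (y * q)
            ≤⟨ +-monoˡ-≤ (7 * (k * q ^ 2) * (y * q)) (+-mono-≤ (*-monoˡ-≤ (a ^ 2) 7a≤yq) (*-monoʳ-≤ (3 * k * q ^ 2) 7a≤yq)) ⟩
          y * q * a ^ 2 + 3 * k * q ^ 2 * (y * q) + 7 * (k * q ^ 2) * (y * q)
            ≡⟨ solve 4 (λ y k q a → y :* q :* a :^ 2 :+ con 3 :* k :* q :^ 2 :* (y :* q) :+ con 7 :* (k :* q :^ 2) :* (y :* q)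
                                := y :* q :* a :^ 2 :+ k :* q :^ 2 :* (con 10 :* (y :* q))) refl y k q a ⟩
          y * q * a ^ 2 + k * q ^ 2 * (10 * (y * q)) ∎))

    d⁶<729q⁶x : ∀ x y q a n d → .{{NonZero n}} → 64 ≤ x → 1 ≤ q → q ^ 6 < x → y ^ 2 ≤ x ^ 3 + x →
                a * n ≤ x → x ≤ n ^ 6 → x ^ 3 * (1 + 2 * d) < 2 * (3 * y * q * a ^ 2) → d ^ 6 < 729 * q ^ 6 * x
    d⁶<729q⁶x x y q a n d 64≤x 1≤q q⁶<x y²≤x³+x an≤x x≤n⁶ x³[1+e]<6yqa² =
      ≰⇒> λ 729q⁶x≤d⁶ → <-irrefl refl (begin-strict
        6 * 12 ^ 5 ≤⟨ *-monoʳ-≤ 6 (^-monoˡ-≤ 5 (12≤e 729q⁶x≤d⁶)) ⟩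
        6 * e ^ 5  <⟨ 6e⁵<4·6⁶ 729q⁶x≤d⁶ ⟩
        4 * 6 ^ 6  ≤⟨ ≤ᵇ⇒≤ (4 * 6 ^ 6) (6 * 12 ^ 5) _ ⟩
        6 * 12 ^ 5 ∎)
      where
      instance
        x≢0 : NonZero x
        x≢0 = >-nonZero (<-≤-trans z<s 64≤x)
      -- With e = 2d the claim reads e⁶ < v x; if it failed, e ≥ 12 and yet 6e⁵ < 4·6⁶.
      e : ℕ
      e = 2 * d
      v : ℕ
      v = 6 ^ 6 * q ^ 6
      x[1+e]n²<6yq : x * (1 + e) * n ^ 2 < 6 * y * q
      x[1+e]n²<6yq = *-cancelˡ-< (x ^ 2) _ _ (begin-strict
        x ^ 2 * (x * (1 + e) * n ^ 2) ≡⟨ solve 3 (λ x e n → x :^ 2 :* (x :* (con 1 :+ e) :* n :^ 2) := x :^ 3 :* (con 1 :+ e) :* n :^ 2) refl x e n ⟩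
        x ^ 3 * (1 + e) * n ^ 2       <⟨ *-monoˡ-< (n ^ 2) {{m^n≢0 n 2}} x³[1+e]<6yqa² ⟩
        2 * (3 * y * q * a ^ 2) * n ^ 2 ≡⟨ solve 4 (λ y q a n → con 2 :* (con 3 :* y :* q :* a :^ 2) :* n :^ 2 := con 6 :* y :* q :* (a :* n) :^ 2) refl y q a n ⟩
        6 * y * q * (a * n) ^ 2       ≤⟨ *-monoʳ-≤ (6 * y * q) (^-monoˡ-≤ 2 an≤x) ⟩
        6 * y * q * x ^ 2             ≡⟨ *-comm (6 * y * q) (x ^ 2) ⟩
        x ^ 2 * (6 * y * q)           ∎)
      -- stated for a variable c: the solver instantiated at c = 6 makes Agda normalise 6⁶ and is very slow
      [cyq]⁶≡c⁶q⁶[y²]³ : ∀ c → (c * y * q) ^ 6 ≡ c ^ 6 * q ^ 6 * (y ^ 2) ^ 3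
      [cyq]⁶≡c⁶q⁶[y²]³ c = solve 3 (λ c y q → (c :* y :* q) :^ 6 := c :^ 6 :* q :^ 6 :* (y :^ 2) :^ 3) refl c y q
      x⁸[1+e]⁶<v[x⁹+4x⁷] : x ^ 8 * (1 + e) ^ 6 < v * (x ^ 9 + 4 * x ^ 7)
      x⁸[1+e]⁶<v[x⁹+4x⁷] = begin-strict
        x ^ 8 * (1 + e) ^ 6               ≡⟨ solve 2 (λ x e → x :^ 8 :* (con 1 :+ e) :^ 6 := x :^ 6 :* (con 1 :+ e) :^ 6 :* x :^ 2) refl x e ⟩
        x ^ 6 * (1 + e) ^ 6 * x ^ 2       ≤⟨ *-monoʳ-≤ (x ^ 6 * (1 + e) ^ 6) (^-monoˡ-≤ 2 x≤n⁶) ⟩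
        x ^ 6 * (1 + e) ^ 6 * (n ^ 6) ^ 2 ≡⟨ solve 3 (λ x e n → x :^ 6 :* (con 1 :+ e) :^ 6 :* (n :^ 6) :^ 2 := (x :* (con 1 :+ e) :* n :^ 2) :^ 6) refl x e n ⟩
        (x * (1 + e) * n ^ 2) ^ 6         <⟨ ^-monoˡ-< 6 x[1+e]n²<6yq ⟩
        (6 * y * q) ^ 6                   ≡⟨ [cyq]⁶≡c⁶q⁶[y²]³ 6 ⟩
        v * (y ^ 2) ^ 3                   ≤⟨ *-monoʳ-≤ v (y²≤x³+x⇒y⁶≤x⁹+4x⁷ x y (≤-trans (≤ᵇ⇒≤ 2 64 _) 64≤x) y²≤x³+x) ⟩
        v * (x ^ 9 + 4 * x ^ 7)           ∎
      vx≤e⁶ : 729 * q ^ 6 * x ≤ d ^ 6 → v * x ≤ e ^ 6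
      vx≤e⁶ 729q⁶x≤d⁶ = begin
        v * x                ≡⟨ solve 4 (λ a b w x → a :* b :* w :* x := a :* (b :* w :* x)) refl 64 729 (q ^ 6) x ⟩
        64 * (729 * q ^ 6 * x) ≤⟨ *-monoʳ-≤ 64 729q⁶x≤d⁶ ⟩
        64 * d ^ 6           ≡⟨ solve 1 (λ d → con 64 :* d :^ 6 := (con 2 :* d) :^ 6) refl d ⟩
        e ^ 6                ∎
      12≤e : 729 * q ^ 6 * x ≤ d ^ 6 → 12 ≤ e
      12≤e 729q⁶x≤d⁶ = ≮⇒≥ λ e<12 → <⇒≱ (^-monoˡ-< 6 e<12) (begin
        12 ^ 6        ≡⟨⟩
        6 ^ 6 * 1 * 64 ≤⟨ *-mono-≤ (*-monoʳ-≤ (6 ^ 6) (^-monoˡ-≤ 6 1≤q)) 64≤x ⟩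
        v * x         ≤⟨ vx≤e⁶ 729q⁶x≤d⁶ ⟩
        e ^ 6         ∎)
      -- (1 + e)⁶ ≥ e⁶ + 6e⁵, and the e⁶ part is absorbed by v x ≤ e⁶
      6e⁵<4·6⁶ : 729 * q ^ 6 * x ≤ d ^ 6 → 6 * e ^ 5 < 4 * 6 ^ 6
      6e⁵<4·6⁶ 729q⁶x≤d⁶ = *-cancelʳ-< x _ _ (*-cancelˡ-< (x ^ 7) _ _ (begin-strict
        x ^ 7 * (6 * e ^ 5 * x)
          ≡⟨ solve 2 (λ x e → x :^ 7 :* (con 6 :* e :^ 5 :* x) := x :^ 8 :* (con 6 :* e :^ 5)) refl x e ⟩
        x ^ 8 * (6 * e ^ 5)
          <⟨ +-cancelˡ-< (x ^ 8 * e ^ 6) _ _ (begin-strict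
            x ^ 8 * e ^ 6 + x ^ 8 * (6 * e ^ 5)
              ≤⟨ ≤-reflexive (sym (*-distribˡ-+ (x ^ 8) (e ^ 6) (6 * e ^ 5))) ⟩
            x ^ 8 * (e ^ 6 + 6 * e ^ 5)
              ≤⟨ *-monoʳ-≤ (x ^ 8) (≤-trans (m≤m+n _ _) (≤-reflexive (solve 1 (λ e → e :^ 6 :+ con 6 :* e :^ 5 :+ (con 15 :* e :^ 4 :+ con 20 :* e :^ 3 :+ con 15 :* e :^ 2 :+ con 6 :* e :+ con 1) := (con 1 :+ e) :^ 6) refl e))) ⟩
            x ^ 8 * (1 + e) ^ 6
              <⟨ x⁸[1+e]⁶<v[x⁹+4x⁷] ⟩
            v * (x ^ 9 + 4 * x ^ 7)
              ≡⟨ solve 2 (λ v x → v :* (x :^ 9 :+ con 4 :* x :^ 7) := v :* x :* x :^ 8 :+ con 4 :* v :* x :^ 7) refl v x ⟩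
            v * x * x ^ 8 + 4 * v * x ^ 7
              ≤⟨ +-monoˡ-≤ (4 * v * x ^ 7) (*-monoˡ-≤ (x ^ 8) (vx≤e⁶ 729q⁶x≤d⁶)) ⟩
            e ^ 6 * x ^ 8 + 4 * v * x ^ 7
              ≡⟨ cong (_+ 4 * v * x ^ 7) (*-comm (e ^ 6) (x ^ 8)) ⟩
            x ^ 8 * e ^ 6 + 4 * v * x ^ 7 ∎) ⟩
        4 * v * x ^ 7
          ≤⟨ *-monoˡ-≤ (x ^ 7) (*-monoʳ-≤ 4 (*-monoʳ-≤ (6 ^ 6) (<⇒≤ q⁶<x))) ⟩
        4 * (6 ^ 6 * x) * x ^ 7
          ≡⟨ solve 3 (λ a b x → a :* (b :* x) :* x :^ 7 := x :^ 7 :* (a :* b :* x)) refl 4 (6 ^ 6) x ⟩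
        x ^ 7 * (4 * 6 ^ 6 * x) ∎))

    c[1+d]≤m+r⇒c[1+2d]<2m : ∀ c m r d → 2 * r < c → c * (1 + d) ≤ m + r → c * (1 + 2 * d) < 2 * m
    c[1+d]≤m+r⇒c[1+2d]<2m c m r d 2r<c c[1+d]≤m+r = +-cancelˡ-< c _ _ (begin-strict
      c + c * (1 + 2 * d) ≡⟨ solve 2 (λ c d → c :+ c :* (con 1 :+ con 2 :* d) := con 2 :* (c :* (con 1 :+ d))) refl c d ⟩
      2 * (c * (1 + d))   ≤⟨ *-monoʳ-≤ 2 c[1+d]≤m+r ⟩
      2 * (m + r)         ≡⟨ solve 2 (λ m r → con 2 :* (m :+ r) := con 2 :* r :+ con 2 :* m) refl m r ⟩
      2 * r + 2 * m       <⟨ +-monoˡ-< (2 * m) 2r<c ⟩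
      c + 2 * m           ∎)

    2a≤x⇒a<x : ∀ a x → 0 < x → 2 * a ≤ x → a < x
    2a≤x⇒a<x zero    x 0<x _    = 0<x
    2a≤x⇒a<x (suc a) x _   2a≤x = <-≤-trans (m<m+n (suc a) z<s) (subst (_≤ x) (cong (_+_ (suc a)) (+-identityʳ (suc a))) 2a≤x)

  open Estimates

  pos-^ : ∀ m n → (+ m) ℤ.^ n ≡ + (m ^ n)
  pos-^ m zero    = refl
  pos-^ m (suc n) = trans (cong (ℤ._*_ (+ m)) (pos-^ m n)) (sym (ℤ.pos-* m (m ^ n)))

  ∣i^n∣≡∣i∣^n : ∀ i n → ℤ.∣ i ℤ.^ n ∣ ≡ ℤ.∣ i ∣ ^ n
  ∣i^n∣≡∣i∣^n i zero    = refl
  ∣i^n∣≡∣i∣^n i (suc n) = trans (ℤ.∣i*j∣≡∣i∣*∣j∣ i (i ℤ.^ n)) (cong (ℤ.∣ i ∣ *_) (∣i^n∣≡∣i∣^n i n))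

  i²≡+∣i∣² : ∀ i → i ℤ.^ 2 ≡ + (ℤ.∣ i ∣ ^ 2)
  i²≡+∣i∣² (+ n)    = pos-^ n 2
  i²≡+∣i∣² -[1+ n ] = refl

  >0⇒≡+suc : ∀ i → + 0 ℤ.< i → ∃ λ n → i ≡ + suc n
  >0⇒≡+suc (+ zero)  (ℤ.+<+ ())
  >0⇒≡+suc (+ suc n) _ = n , refl

  +m+r≤0⇒m≤∣r∣ : ∀ m r → + m ℤ.+ r ℤ.≤ + 0 → m ≤ ℤ.∣ r ∣
  +m+r≤0⇒m≤∣r∣ m (+ n)    (ℤ.+≤+ m+n≤0) = ≤-trans (m≤m+n m n) (≤-trans m+n≤0 z≤n)
  +m+r≤0⇒m≤∣r∣ m -[1+ n ] m⊖[1+n]≤0   = ≮⇒≥ λ 1+n<m →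
    <⇒≱ (m<n⇒0<n∸m 1+n<m) (ℤ.drop‿+≤+ (subst (ℤ._≤ + 0) (ℤ.⊖-≥ (<⇒≤ 1+n<m)) m⊖[1+n]≤0))

  +n≡+m+r⇒n≤m+∣r∣ : ∀ n m r → + n ≡ + m ℤ.+ r → n ≤ m + ℤ.∣ r ∣
  +n≡+m+r⇒n≤m+∣r∣ n m r eq = subst (_≤ m + ℤ.∣ r ∣) (cong ℤ.∣_∣ (sym eq)) (ℤ.∣i+j∣≤∣i∣+∣j∣ (+ m) r)

  +n≡+x*h⇒x≤n : ∀ x n h → .{{NonZero n}} → + n ≡ + x ℤ.* h → x ≤ n
  +n≡+x*h⇒x≤n x n h eq = ∣⇒≤ (divides ℤ.∣ h ∣ (trans (cong ℤ.∣_∣ eq) (trans (ℤ.∣i*j∣≡∣i∣*∣j∣ (+ x) h) (*-comm x _))))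

  powers-bracket-below : ∀ e x b → 1 < x → x ≤ suc b ^ e → ∃ λ m → 1 ≤ m × m ^ e < x × x ≤ suc m ^ e
  powers-bracket-below e x zero 1<x x≤1ᵉ = ⊥-elim (<⇒≱ 1<x (≤-trans x≤1ᵉ (≤-reflexive (^-zeroˡ e))))
  powers-bracket-below e x (suc b) 1<x x≤[2+b]ᵉ with x ≤? suc b ^ e
  ... | yes x≤[1+b]ᵉ = powers-bracket-below e x b 1<x x≤[1+b]ᵉ
  ... | no  x≰[1+b]ᵉ = suc b , s≤s z≤n , ≰⇒> x≰[1+b]ᵉ , x≤[2+b]ᵉ

  powers-bracket : ∀ e x → .{{NonZero e}} → 1 < x → ∃ λ m → 1 ≤ m × m ^ e < x × x ≤ suc m ^ e
  powers-bracket e x 1<x = powers-bracket-below e x x 1<x (begin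
    x           ≤⟨ n≤1+n x ⟩
    suc x       ≡⟨ ^-identityʳ (suc x) ⟨
    suc x ^ 1   ≤⟨ ^-monoʳ-≤ (suc x) (>-nonZero⁻¹ e) ⟩
    suc x ^ e   ∎)
    where open ≤-Reasoning

  DirichletApproximation : ℕ → ℕ → ℕ → Set
  DirichletApproximation x y m =
    ∃₂ λ (p : ℤ) (q : ℕ) → 1 ≤ q × q ≤ m × ℤ.∣ p ℤ.* + x ℤ.- + q ℤ.* + y ∣ * suc m ≤ x

  -- The m + 2 numbers iy mod x (i ≤ m) and x lie in [0, x]; two of them fall into the same
  -- one of m + 1 boxes of width (x + 1)/(m + 1).
  module _ (x y m : ℕ) .{{_ : NonZero x}} where
    private
      n : ℕ
      n = suc m

      box : ℕ → ℕ
      box r = r * n / suc x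

      box<n : ∀ r → r ≤ x → box r < n
      box<n r r≤x = m<n*o⇒m/o<n (begin-strict
        r * n     ≤⟨ *-monoˡ-≤ n r≤x ⟩
        x * n     <⟨ *-monoˡ-< n (n<1+n x) ⟩
        suc x * n ≡⟨ *-comm (suc x) n ⟩
        n * suc x ∎)
        where open ≤-Reasoning

      same-box⇒[r∸r′]*n≤x : ∀ r r′ → r′ ≤ r → box r ≡ box r′ → (r ∸ r′) * n ≤ x
      same-box⇒[r∸r′]*n≤x r r′ r′≤r same = begin
        (r ∸ r′) * n ≡⟨ *-distribʳ-∸ n r r′ ⟩
        r * n ∸ r′ * n
          ≡⟨ cong₂ _∸_ (m≡m%n+[m/n]*n (r * n) (suc x)) (m≡m%n+[m/n]*n (r′ * n) (suc x)) ⟩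
        (r * n % suc x + box r * suc x) ∸ (r′ * n % suc x + box r′ * suc x)
          ≡⟨ cong (λ b → (r * n % suc x + b * suc x) ∸ (r′ * n % suc x + box r′ * suc x)) same ⟩
        (r * n % suc x + box r′ * suc x) ∸ (r′ * n % suc x + box r′ * suc x)
          ≡⟨ cong₂ _∸_ (+-comm (r * n % suc x) _) (+-comm (r′ * n % suc x) _) ⟩
        (box r′ * suc x + r * n % suc x) ∸ (box r′ * suc x + r′ * n % suc x)
          ≡⟨ [m+n]∸[m+o]≡n∸o (box r′ * suc x) _ _ ⟩
        r * n % suc x ∸ r′ * n % suc x ≤⟨ m∸n≤m (r * n % suc x) (r′ * n % suc x) ⟩
        r * n % suc x                  ≤⟨ s≤s⁻¹ (m%n<n (r * n) (suc x)) ⟩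
        x                              ∎
        where open ≤-Reasoning

      same-box⇒∣r⊖r′∣*n≤x : ∀ r r′ → box r ≡ box r′ → ℤ.∣ r ⊖ r′ ∣ * n ≤ x
      same-box⇒∣r⊖r′∣*n≤x r r′ same with ≤-total r′ r
      ... | inj₁ r′≤r = subst (λ d → d * n ≤ x) (sym (trans (ℤ.∣m⊖n∣≡∣n⊖m∣ r r′) (ℤ.∣⊖∣-≤ r′≤r)))
                              (same-box⇒[r∸r′]*n≤x r r′ r′≤r same)
      ... | inj₂ r≤r′ = subst (λ d → d * n ≤ x) (sym (ℤ.∣⊖∣-≤ r≤r′))
                              (same-box⇒[r∸r′]*n≤x r′ r r≤r′ (sym same))

      point : ℕ → ℕ
      point i with i ≤? m
      ... | yes _ = i * y % x
      ... | no  _ = x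

      point≤x : ∀ i → point i ≤ x
      point≤x i with i ≤? m
      ... | yes _ = <⇒≤ (m%n<n (i * y) x)
      ... | no  _ = ≤-refl

      point-residue : ∀ i → i ≤ m → point i ≡ i * y % x
      point-residue i i≤m with i ≤? m
      ... | yes _   = refl
      ... | no  i≰m = ⊥-elim (i≰m i≤m)

      point-last : point n ≡ x
      point-last with n ≤? m
      ... | yes n≤m = ⊥-elim (<-irrefl refl n≤m)
      ... | no  _   = refl

      boxed : Fin (suc n) → Fin n
      boxed i = fromℕ< (box<n (point (toℕ i)) (point≤x (toℕ i)))

      boxed≡⇒box≡ : ∀ i j → boxed i ≡ boxed j → box (point (toℕ i)) ≡ box (point (toℕ j))
      boxed≡⇒box≡ i j eq = begin
        box (point (toℕ i)) ≡⟨ toℕ-fromℕ< _ ⟨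
        toℕ (boxed i)       ≡⟨ cong toℕ eq ⟩
        toℕ (boxed j)       ≡⟨ toℕ-fromℕ< _ ⟩
        box (point (toℕ j)) ∎
        where open ≡-Reasoning

      iy≡[iy%x]+[iy/x]x : ∀ i → + i ℤ.* + y ≡ + (i * y % x) ℤ.+ + (i * y / x) ℤ.* + x
      iy≡[iy%x]+[iy/x]x i = begin
        + i ℤ.* + y                             ≡⟨ ℤ.pos-* i y ⟨
        + (i * y)                               ≡⟨ cong +_ (m≡m%n+[m/n]*n (i * y) x) ⟩
        + (i * y % x + i * y / x * x)           ≡⟨ ℤ.pos-+ (i * y % x) (i * y / x * x) ⟩
        + (i * y % x) ℤ.+ + (i * y / x * x)     ≡⟨ cong (ℤ._+_ (+ (i * y % x))) (ℤ.pos-* (i * y / x) x) ⟩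
        + (i * y % x) ℤ.+ + (i * y / x) ℤ.* + x ∎
        where open ≡-Reasoning

      open ℤ.+-*-Solver

      pair-inside : ∀ i j → i < j → j ≤ m → box (point i) ≡ box (point j) → DirichletApproximation x y m
      pair-inside i j i<j j≤m same = p , j ∸ i , m<n⇒0<n∸m i<j , ≤-trans (m∸n≤m j i) j≤m ,
                                     subst (λ d → ℤ.∣ d ∣ * n ≤ x) (sym px-qy≡ri⊖rj) ∣ri⊖rj∣n≤x
        where
        ri : ℕ
        ri = i * y % x
        rj : ℕ
        rj = j * y % x
        p : ℤ
        p = + (j * y / x) ℤ.- + (i * y / x)
        ∣ri⊖rj∣n≤x : ℤ.∣ ri ⊖ rj ∣ * n ≤ x
        ∣ri⊖rj∣n≤x = subst₂ (λ r r′ → ℤ.∣ r ⊖ r′ ∣ * n ≤ x)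
          (point-residue i (≤-trans (<⇒≤ i<j) j≤m)) (point-residue j j≤m)
          (same-box⇒∣r⊖r′∣*n≤x (point i) (point j) same)
        linear : ∀ (ri rj di dj i j y x : ℤ) → j ℤ.* y ≡ rj ℤ.+ dj ℤ.* x → i ℤ.* y ≡ ri ℤ.+ di ℤ.* x →
                 (dj ℤ.- di) ℤ.* x ℤ.- (j ℤ.- i) ℤ.* y ≡ ri ℤ.- rj
        linear ri rj di dj i j y x jy≡ iy≡ = begin
          (dj ℤ.- di) ℤ.* x ℤ.- (j ℤ.- i) ℤ.* y
            ≡⟨ solve 6 (λ di dj i j y x → (dj :- di) :* x :- (j :- i) :* y := i :* y :- di :* x :- (j :* y :- dj :* x)) refl di dj i j y x ⟩
          i ℤ.* y ℤ.- di ℤ.* x ℤ.- (j ℤ.* y ℤ.- dj ℤ.* x)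
            ≡⟨ cong₂ (λ a b → a ℤ.- di ℤ.* x ℤ.- (b ℤ.- dj ℤ.* x)) iy≡ jy≡ ⟩
          ri ℤ.+ di ℤ.* x ℤ.- di ℤ.* x ℤ.- (rj ℤ.+ dj ℤ.* x ℤ.- dj ℤ.* x)
            ≡⟨ solve 4 (λ ri rj a b → ri :+ a :- a :- (rj :+ b :- b) := ri :- rj) refl ri rj (di ℤ.* x) (dj ℤ.* x) ⟩
          ri ℤ.- rj ∎
          where open ≡-Reasoning
        px-qy≡ri⊖rj : p ℤ.* + x ℤ.- + (j ∸ i) ℤ.* + y ≡ ri ⊖ rj
        px-qy≡ri⊖rj = begin
          p ℤ.* + x ℤ.- + (j ∸ i) ℤ.* + y
            ≡⟨ cong (λ d → p ℤ.* + x ℤ.- d ℤ.* + y) (trans (ℤ.[+m]-[+n]≡m⊖n j i) (ℤ.⊖-≥ (<⇒≤ i<j))) ⟨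
          p ℤ.* + x ℤ.- (+ j ℤ.- + i) ℤ.* + y
            ≡⟨ linear (+ ri) (+ rj) (+ (i * y / x)) (+ (j * y / x)) (+ i) (+ j) (+ y) (+ x) (iy≡[iy%x]+[iy/x]x j) (iy≡[iy%x]+[iy/x]x i) ⟩
          + ri ℤ.- + rj
            ≡⟨ ℤ.[+m]-[+n]≡m⊖n ri rj ⟩
          ri ⊖ rj ∎
          where open ≡-Reasoning

      pair-with-last : ∀ i → 1 ≤ i → i ≤ m → box (point i) ≡ box (point n) → DirichletApproximation x y m
      pair-with-last i 1≤i i≤m same = p , i , 1≤i , i≤m , subst (λ d → ℤ.∣ d ∣ * n ≤ x) (sym px-iy≡x⊖ri) ∣x⊖ri∣n≤x
        where
        ri : ℕ
        ri = i * y % x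
        d : ℤ
        d = + (i * y / x)
        p : ℤ
        p = d ℤ.+ + 1
        ∣x⊖ri∣n≤x : ℤ.∣ x ⊖ ri ∣ * n ≤ x
        ∣x⊖ri∣n≤x = subst₂ (λ r r′ → ℤ.∣ r′ ⊖ r ∣ * n ≤ x) (point-residue i i≤m) point-last
          (subst (λ δ → δ * n ≤ x) (ℤ.∣m⊖n∣≡∣n⊖m∣ (point i) (point n))
            (same-box⇒∣r⊖r′∣*n≤x (point i) (point n) same))
        px-iy≡x⊖ri : p ℤ.* + x ℤ.- + i ℤ.* + y ≡ x ⊖ ri
        px-iy≡x⊖ri = begin
          p ℤ.* + x ℤ.- + i ℤ.* + y         ≡⟨ cong (λ t → p ℤ.* + x ℤ.- t) (iy≡[iy%x]+[iy/x]x i) ⟩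
          p ℤ.* + x ℤ.- (+ ri ℤ.+ d ℤ.* + x) ≡⟨ solve 3 (λ d r x → (d :+ con (+ 1)) :* x :- (r :+ d :* x) := x :- r) refl d (+ ri) (+ x) ⟩
          + x ℤ.- + ri                       ≡⟨ ℤ.[+m]-[+n]≡m⊖n x ri ⟩
          x ⊖ ri                             ∎
          where open ≡-Reasoning

      first-and-last-boxes-differ : 1 ≤ m → box (point 0) ≢ box (point n)
      first-and-last-boxes-differ 1≤m same = <-irrefl (sym box0≡0) (subst (0 <_) (sym same) (subst (λ r → 0 < box r) (sym point-last) boxx>0))
        where
        box0≡0 : box (point 0) ≡ 0
        box0≡0 = cong box (trans (point-residue 0 z≤n) (m<n⇒m%n≡m (>-nonZero⁻¹ x)))
        boxx>0 : 0 < box x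
        boxx>0 = m≥n⇒m/n>0 (begin
          suc x ≡⟨ +-comm 1 x ⟩
          x + 1 ≤⟨ +-monoʳ-≤ x (>-nonZero⁻¹ x) ⟩
          x + x ≡⟨ cong (_+_ x) (+-identityʳ x) ⟨
          2 * x ≤⟨ *-monoˡ-≤ x (s≤s 1≤m) ⟩
          n * x ≡⟨ *-comm n x ⟩
          x * n ∎)
          where open ≤-Reasoning

    dirichlet : 1 ≤ m → DirichletApproximation x y m
    dirichlet 1≤m with pigeonhole (n<1+n n) boxed
    ... | i , j , i<j , same = from-pair (toℕ i) (toℕ j) i<j (s≤s⁻¹ (toℕ<n j)) (boxed≡⇒box≡ i j same)
      where
      from-last-pair : ∀ i → i < n → box (point i) ≡ box (point n) → DirichletApproximation x y m
      from-last-pair zero    _   same = ⊥-elim (first-and-last-boxes-differ 1≤m same)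
      from-last-pair (suc i) i<n same = pair-with-last (suc i) (s≤s z≤n) (s≤s⁻¹ i<n) same
      from-pair : ∀ i j → i < j → j ≤ n → box (point i) ≡ box (point j) → DirichletApproximation x y m
      from-pair i j i<j j≤n same with ≤-<-connex j m
      ... | inj₁ j≤m = pair-inside i j i<j j≤m same
      ... | inj₂ m<j = from-last-pair i (subst (i <_) j≡n i<j) (subst (λ j → box (point i) ≡ box (point j)) j≡n same)
        where
        j≡n : j ≡ n
        j≡n = ≤-antisym j≤n m<j

  module _ where
    open ℤ.+-*-Solver

    C-expansion : ∀ p q x y k → k ≡ x ℤ.^ 3 ℤ.- y ℤ.^ 2 →
      x ℤ.^ 3 ℤ.* C q p x y ≡ + 3 ℤ.* y ℤ.* q ℤ.* (p ℤ.* x ℤ.- q ℤ.* y) ℤ.^ 2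
        ℤ.+ ((p ℤ.* x ℤ.- q ℤ.* y) ℤ.^ 3 ℤ.- + 3 ℤ.* k ℤ.* q ℤ.^ 2 ℤ.* (p ℤ.* x ℤ.- q ℤ.* y) ℤ.- k ℤ.* (y ℤ.* q ℤ.^ 3))
    C-expansion p q x y _ refl = solve 4 (λ p q x y →
      x :^ 3 :* (p :^ 3 :- con (+ 3) :* p :* q :^ 2 :* x :+ con (+ 2) :* q :^ 3 :* y)
        := con (+ 3) :* y :* q :* (p :* x :- q :* y) :^ 2
           :+ ((p :* x :- q :* y) :^ 3 :- con (+ 3) :* (x :^ 3 :- y :^ 2) :* q :^ 2 :* (p :* x :- q :* y)
               :- (x :^ 3 :- y :^ 2) :* (y :* q :^ 3))) refl p q x y

    u²+kq²≡x*h : ∀ p q x y k → k ≡ x ℤ.^ 3 ℤ.- y ℤ.^ 2 →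
      (p ℤ.* x ℤ.- q ℤ.* y) ℤ.^ 2 ℤ.+ k ℤ.* q ℤ.^ 2 ≡ x ℤ.* (x ℤ.* p ℤ.^ 2 ℤ.- + 2 ℤ.* y ℤ.* p ℤ.* q ℤ.+ x ℤ.^ 2 ℤ.* q ℤ.^ 2)
    u²+kq²≡x*h p q x y _ refl = solve 4 (λ p q x y →
      (p :* x :- q :* y) :^ 2 :+ (x :^ 3 :- y :^ 2) :* q :^ 2
        := x :* (x :* p :^ 2 :- con (+ 2) :* y :* p :* q :+ x :^ 2 :* q :^ 2)) refl p q x y

  BoundedCPair : ℤ → ℤ → Set
  BoundedCPair x y = ∃₂ λ (p q : ℤ) → (+ 0 ℤ.< p) × (+ 0 ℤ.< q) × (+ 0 ℤ.< C q p x y)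
    × ((C q p x y ℤ.- + 1) ℤ.^ 6 ℤ.< + 729 ℤ.* q ℤ.^ 6 ℤ.* x) × (q ℤ.^ 6 ℤ.< x) × ((p ℤ.- + 1) ℤ.^ 3 ℤ.< x ℤ.^ 2)

  module GoodPair (X Y : ℕ) (k : ℤ) (k≡x³-y² : k ≡ (+ X) ℤ.^ 3 ℤ.- (+ Y) ℤ.^ 2)
                  (k≢0 : k ≢ + 0) (k²<x : k ℤ.^ 2 ℤ.< + X) where

    K : ℕ
    K = ℤ.∣ k ∣

    K²<X : K ^ 2 < X
    K²<X = ℤ.drop‿+<+ (subst (ℤ._< + X) (i²≡+∣i∣² k) k²<x)

    1≤K : 1 ≤ K
    1≤K = n≢0⇒n>0 (k≢0 ∘ ℤ.∣i∣≡0⇒i≡0)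

    K<X : K < X
    K<X = ≤-<-trans (≤-trans (≤-reflexive (sym (^-identityʳ K))) (^-monoʳ-≤ K {{>-nonZero 1≤K}} (≤ᵇ⇒≤ 1 2 _))) K²<X

    X³≡Y²+K⊎Y²≡X³+K : X ^ 3 ≡ Y ^ 2 + K ⊎ Y ^ 2 ≡ X ^ 3 + K
    X³≡Y²+K⊎Y²≡X³+K with ℤ.+∣i∣≡i⊎+∣i∣≡-i k
    ... | inj₁ +K≡k  = inj₁ (ℤ.+-injective (begin
      + (X ^ 3)                                          ≡⟨ pos-^ X 3 ⟨
      (+ X) ℤ.^ 3                                        ≡⟨ solve 2 (λ x y → x :^ 3 := y :^ 2 :+ (x :^ 3 :- y :^ 2)) refl (+ X) (+ Y) ⟩
      (+ Y) ℤ.^ 2 ℤ.+ ((+ X) ℤ.^ 3 ℤ.- (+ Y) ℤ.^ 2)     ≡⟨ cong₂ ℤ._+_ (pos-^ Y 2) (trans (sym k≡x³-y²) (sym +K≡k)) ⟩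
      + (Y ^ 2 + K)                                      ∎))
      where
      open ≡-Reasoning
      open ℤ.+-*-Solver
    ... | inj₂ +K≡-k = inj₂ (ℤ.+-injective (begin
      + (Y ^ 2)                                          ≡⟨ pos-^ Y 2 ⟨
      (+ Y) ℤ.^ 2                                        ≡⟨ solve 2 (λ x y → y :^ 2 := x :^ 3 :+ :- (x :^ 3 :- y :^ 2)) refl (+ X) (+ Y) ⟩
      (+ X) ℤ.^ 3 ℤ.+ ℤ.- ((+ X) ℤ.^ 3 ℤ.- (+ Y) ℤ.^ 2) ≡⟨ cong₂ ℤ._+_ (pos-^ X 3) (trans (cong ℤ.-_ (sym k≡x³-y²)) (sym +K≡-k)) ⟩
      + (X ^ 3 + K)                                      ∎))
      where
      open ≡-Reasoning
      open ℤ.+-*-Solver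

    X³≤Y²+K : X ^ 3 ≤ Y ^ 2 + K
    X³≤Y²+K with X³≡Y²+K⊎Y²≡X³+K
    ... | inj₁ X³≡Y²+K = ≤-reflexive X³≡Y²+K
    ... | inj₂ Y²≡X³+K = ≤-trans (m≤m+n (X ^ 3) K) (≤-trans (≤-reflexive (sym Y²≡X³+K)) (m≤m+n (Y ^ 2) K))

    Y²≤X³+X : Y ^ 2 ≤ X ^ 3 + X
    Y²≤X³+X with X³≡Y²+K⊎Y²≡X³+K
    ... | inj₁ X³≡Y²+K = ≤-trans (m≤m+n (Y ^ 2) K) (≤-trans (≤-reflexive (sym X³≡Y²+K)) (m≤m+n (X ^ 3) X))
    ... | inj₂ Y²≡X³+K = ≤-trans (≤-reflexive Y²≡X³+K) (+-monoʳ-≤ (X ^ 3) (<⇒≤ K<X))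

  module LargeCase (X Y : ℕ) (k : ℤ) (k≡x³-y² : k ≡ (+ X) ℤ.^ 3 ℤ.- (+ Y) ℤ.^ 2)
                (k≢0 : k ≢ + 0) (k²<x : k ℤ.^ 2 ℤ.< + X) (64≤X : 64 ≤ X) where

    open GoodPair X Y k k≡x³-y² k≢0 k²<x

    instance
      X≢0 : NonZero X
      X≢0 = >-nonZero (<-≤-trans z<s 64≤X)

    7X<Y : 7 * X < Y
    7X<Y = x³≤y²+k⇒7x<y X Y K (≤-trans (≤ᵇ⇒≤ 50 64 _) 64≤X) K<X X³≤Y²+K

    module Approximant (P : ℤ) (Q : ℕ) (1≤Q : 1 ≤ Q) (Q⁶<X : Q ^ 6 < X)
                       (2a≤X : 2 * ℤ.∣ P ℤ.* + X ℤ.- + Q ℤ.* + Y ∣ ≤ X) where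

      u : ℤ
      u = P ℤ.* + X ℤ.- + Q ℤ.* + Y

      a : ℕ
      a = ℤ.∣ u ∣

      c : ℤ
      c = C (+ Q) P (+ X) (+ Y)

      14a<YQ : 14 * a < Y * Q
      14a<YQ = begin-strict
        14 * a      ≡⟨ *-assoc 7 2 a ⟩
        7 * (2 * a) ≤⟨ *-monoʳ-≤ 7 2a≤X ⟩
        7 * X       <⟨ 7X<Y ⟩
        Y           ≤⟨ m≤m*n Y Q {{>-nonZero 1≤Q}} ⟩
        Y * Q       ∎
        where open ≤-Reasoning

      3KQ²<2X : 3 * K * Q ^ 2 < 2 * X
      3KQ²<2X = 3kq²<2x X K Q (≤-trans (≤ᵇ⇒≤ 12 64 _) 64≤X) K²<X Q⁶<X

      main : ℕ
      main = 3 * Y * Q * a ^ 2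

      R₁ : ℤ
      R₁ = u ℤ.^ 3 ℤ.- + 3 ℤ.* k ℤ.* (+ Q) ℤ.^ 2 ℤ.* u

      R : ℤ
      R = R₁ ℤ.- k ℤ.* + (Y * Q ^ 3)

      X³c≡main+R : + (X ^ 3) ℤ.* c ≡ + main ℤ.+ R
      X³c≡main+R = begin
        + (X ^ 3) ℤ.* c                                      ≡⟨ cong (ℤ._* c) (pos-^ X 3) ⟨
        (+ X) ℤ.^ 3 ℤ.* c                                    ≡⟨ C-expansion P (+ Q) (+ X) (+ Y) k k≡x³-y² ⟩
        + 3 ℤ.* + Y ℤ.* + Q ℤ.* u ℤ.^ 2 ℤ.+ (R₁ ℤ.- k ℤ.* (+ Y ℤ.* (+ Q) ℤ.^ 3))
          ≡⟨ cong₂ (λ m w → m ℤ.+ (R₁ ℤ.- k ℤ.* w)) +3YQu²≡+main +Y+Q³≡+YQ³ ⟩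
        + main ℤ.+ R                                         ∎
        where
        open ≡-Reasoning
        +3YQu²≡+main : + 3 ℤ.* + Y ℤ.* + Q ℤ.* u ℤ.^ 2 ≡ + main
        +3YQu²≡+main = begin
          + 3 ℤ.* + Y ℤ.* + Q ℤ.* u ℤ.^ 2   ≡⟨ cong (ℤ._*_ (+ 3 ℤ.* + Y ℤ.* + Q)) (i²≡+∣i∣² u) ⟩
          + 3 ℤ.* + Y ℤ.* + Q ℤ.* + (a ^ 2) ≡⟨ cong (λ t → t ℤ.* + Q ℤ.* + (a ^ 2)) (ℤ.pos-* 3 Y) ⟨
          + (3 * Y) ℤ.* + Q ℤ.* + (a ^ 2)   ≡⟨ cong (ℤ._* + (a ^ 2)) (ℤ.pos-* (3 * Y) Q) ⟨
          + (3 * Y * Q) ℤ.* + (a ^ 2)       ≡⟨ ℤ.pos-* (3 * Y * Q) (a ^ 2) ⟨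
          + main                            ∎
        +Y+Q³≡+YQ³ : + Y ℤ.* (+ Q) ℤ.^ 3 ≡ + (Y * Q ^ 3)
        +Y+Q³≡+YQ³ = trans (cong (ℤ._*_ (+ Y)) (pos-^ Q 3)) (sym (ℤ.pos-* Y (Q ^ 3)))

      ∣R₁∣≤a³+3KQ²a : ℤ.∣ R₁ ∣ ≤ a ^ 3 + 3 * K * Q ^ 2 * a
      ∣R₁∣≤a³+3KQ²a = ≤-trans (ℤ.∣i-j∣≤∣i∣+∣j∣ (u ℤ.^ 3) (+ 3 ℤ.* k ℤ.* (+ Q) ℤ.^ 2 ℤ.* u))
        (≤-reflexive (cong₂ _+_ (∣i^n∣≡∣i∣^n u 3)
          (trans (ℤ.∣i*j∣≡∣i∣*∣j∣ (+ 3 ℤ.* k ℤ.* (+ Q) ℤ.^ 2) u)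
            (cong (_* a) (trans (ℤ.∣i*j∣≡∣i∣*∣j∣ (+ 3 ℤ.* k) ((+ Q) ℤ.^ 2))
              (cong₂ _*_ (ℤ.∣i*j∣≡∣i∣*∣j∣ (+ 3) k) (∣i^n∣≡∣i∣^n (+ Q) 2)))))))

      ∣R∣≤remainderBound : ℤ.∣ R ∣ ≤ remainderBound Y K Q a
      ∣R∣≤remainderBound = ≤-trans (ℤ.∣i-j∣≤∣i∣+∣j∣ R₁ (k ℤ.* + (Y * Q ^ 3)))
        (+-mono-≤ ∣R₁∣≤a³+3KQ²a (≤-reflexive (ℤ.∣i*j∣≡∣i∣*∣j∣ k (+ (Y * Q ^ 3)))))

      2remainderBound<X³ : 2 * remainderBound Y K Q a < X ^ 3
      2remainderBound<X³ = 2*remainderBound<x³ X Y K Q a 64≤X K²<X Q⁶<X Y²≤X³+X 2a≤X 3KQ²<2X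

      C-positive : + 0 ℤ.< c
      C-positive = ℤ.≰⇒> c≰0
        where
        main+R≤0 : c ℤ.≤ + 0 → + main ℤ.+ R ℤ.≤ + 0
        main+R≤0 c≤0 = subst (ℤ._≤ + 0) X³c≡main+R
          (ℤ.≤-trans (ℤ.*-monoˡ-≤-nonNeg (+ (X ^ 3)) c≤0) (ℤ.≤-reflexive (ℤ.*-zeroʳ (+ (X ^ 3)))))
        c≰0 : ¬ c ℤ.≤ + 0
        c≰0 c≤0 with ℤ.+∣i∣≡i⊎+∣i∣≡-i k
        ... | inj₁ +K≡k  = <⇒≱ a²+KQ²<X X≤a²+KQ²
          where
          a²+KQ²<X : a ^ 2 + K * Q ^ 2 < X
          a²+KQ²<X = 3yqa²≤remainderBound⇒a²+kq²<x X Y K Q a (≤-trans (s≤s z≤n) 14a<YQ)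
            (≤-trans (*-monoˡ-≤ a (≤ᵇ⇒≤ 7 14 _)) (<⇒≤ 14a<YQ)) 3KQ²<2X
            (≤-trans (+m+r≤0⇒m≤∣r∣ main R (main+R≤0 c≤0)) ∣R∣≤remainderBound)
          X≤a²+KQ² : X ≤ a ^ 2 + K * Q ^ 2
          X≤a²+KQ² = +n≡+x*h⇒x≤n X (a ^ 2 + K * Q ^ 2) _
            {{>-nonZero (≤-trans (*-mono-≤ 1≤K (^-monoˡ-≤ 2 1≤Q)) (m≤n+m (K * Q ^ 2) (a ^ 2)))}}
            (begin
              + (a ^ 2 + K * Q ^ 2)        ≡⟨ cong₂ ℤ._+_ (i²≡+∣i∣² u) (sym (trans (ℤ.pos-* K (Q ^ 2)) (cong₂ ℤ._*_ +K≡k (sym (pos-^ Q 2))))) ⟨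
              u ℤ.^ 2 ℤ.+ k ℤ.* (+ Q) ℤ.^ 2 ≡⟨ u²+kq²≡x*h P (+ Q) (+ X) (+ Y) k k≡x³-y² ⟩
              _                            ∎)
            where open ≡-Reasoning
        ... | inj₂ +K≡-k = <⇒≱ (a³+3kq²a<3yqa²+kyq³ Y K Q a 1≤K 1≤Q 3a<YQ)
            (≤-trans (+m+r≤0⇒m≤∣r∣ _ R₁ (subst (ℤ._≤ + 0) R-split (main+R≤0 c≤0))) ∣R₁∣≤a³+3KQ²a)
          where
          3a<YQ : 3 * a < Y * Q
          3a<YQ = ≤-<-trans (*-monoˡ-≤ a (≤ᵇ⇒≤ 3 14 _)) 14a<YQ
          R-split : + main ℤ.+ R ≡ + (main + K * (Y * Q ^ 3)) ℤ.+ R₁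
          R-split = begin
            + main ℤ.+ (R₁ ℤ.- k ℤ.* + (Y * Q ^ 3))
              ≡⟨ solve 4 (λ m r k w → m :+ (r :- k :* w) := m :+ (:- k) :* w :+ r) refl (+ main) R₁ k (+ (Y * Q ^ 3)) ⟩
            + main ℤ.+ ℤ.- k ℤ.* + (Y * Q ^ 3) ℤ.+ R₁
              ≡⟨ cong (λ t → + main ℤ.+ t ℤ.+ R₁) (trans (cong (ℤ._* + (Y * Q ^ 3)) (sym +K≡-k)) (sym (ℤ.pos-* K (Y * Q ^ 3)))) ⟩
            + (main + K * (Y * Q ^ 3)) ℤ.+ R₁ ∎
            where
            open ≡-Reasoning
            open ℤ.+-*-Solver

      Px≡QY+u : P ℤ.* + X ≡ + (Q * Y) ℤ.+ u
      Px≡QY+u = trans (solve 4 (λ p q x y → p :* x := q :* y :+ (p :* x :- q :* y)) refl P (+ Q) (+ X) (+ Y))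
                      (cong (ℤ._+ u) (sym (ℤ.pos-* Q Y)))
        where open ℤ.+-*-Solver

      a<QY : a < Q * Y
      a<QY = begin-strict
        a      ≤⟨ m≤n*m a 14 ⟩
        14 * a <⟨ 14a<YQ ⟩
        Y * Q  ≡⟨ *-comm Y Q ⟩
        Q * Y  ∎
        where open ≤-Reasoning

      P-positive : + 0 ℤ.< P
      P-positive = ℤ.≰⇒> λ P≤0 → <⇒≱ a<QY
        (+m+r≤0⇒m≤∣r∣ (Q * Y) u (subst (ℤ._≤ + 0) Px≡QY+u (ℤ.*-monoʳ-≤-nonNeg (+ X) P≤0)))

      [P-1]³<X² : (P ℤ.- + 1) ℤ.^ 3 ℤ.< (+ X) ℤ.^ 2
      [P-1]³<X² = from-successor (>0⇒≡+suc P P-positive)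
        where
        from-successor : (∃ λ P′ → P ≡ + suc P′) → (P ℤ.- + 1) ℤ.^ 3 ℤ.< (+ X) ℤ.^ 2
        from-successor (P′ , P≡1+P′) =
          subst₂ ℤ._<_ (trans (sym (pos-^ P′ 3)) (cong (λ p → (p ℤ.- + 1) ℤ.^ 3) (sym P≡1+P′))) (sym (pos-^ X 2))
                 (ℤ.+<+ (px<qy⇒p³<x² X Y Q P′ 64≤X Q⁶<X Y²≤X³+X P′X<QY))
          where
          P′X<QY : P′ * X < Q * Y
          P′X<QY = +-cancelˡ-< X (P′ * X) (Q * Y) (begin-strict
            suc P′ * X ≤⟨ +n≡+m+r⇒n≤m+∣r∣ (suc P′ * X) (Q * Y) u
                            (trans (ℤ.pos-* (suc P′) X) (trans (cong (ℤ._* + X) (sym P≡1+P′)) Px≡QY+u)) ⟩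
            Q * Y + a  <⟨ +-monoʳ-< (Q * Y) (2a≤x⇒a<x a X (>-nonZero⁻¹ X) 2a≤X) ⟩
            Q * Y + X  ≡⟨ +-comm (Q * Y) X ⟩
            X + Q * Y  ∎)
            where open ≤-Reasoning

      [c-1]⁶<729Q⁶X : ∀ n → .{{NonZero n}} → a * n ≤ X → X ≤ n ^ 6 → (c ℤ.- + 1) ℤ.^ 6 ℤ.< + 729 ℤ.* (+ Q) ℤ.^ 6 ℤ.* + X
      [c-1]⁶<729Q⁶X n an≤X X≤n⁶ = from-successor (>0⇒≡+suc c C-positive)
        where
        +729Q⁶X : + (729 * Q ^ 6 * X) ≡ + 729 ℤ.* (+ Q) ℤ.^ 6 ℤ.* + X
        +729Q⁶X = trans (ℤ.pos-* (729 * Q ^ 6) X) (cong (ℤ._* + X) (trans (ℤ.pos-* 729 (Q ^ 6)) (cong (ℤ._*_ (+ 729)) (sym (pos-^ Q 6)))))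
        from-successor : (∃ λ d → c ≡ + suc d) → (c ℤ.- + 1) ℤ.^ 6 ℤ.< + 729 ℤ.* (+ Q) ℤ.^ 6 ℤ.* + X
        from-successor (d , c≡1+d) =
          subst₂ ℤ._<_ (trans (sym (pos-^ d 6)) (cong (λ t → (t ℤ.- + 1) ℤ.^ 6) (sym c≡1+d))) +729Q⁶X
                 (ℤ.+<+ (d⁶<729q⁶x X Y Q a n d 64≤X 1≤Q Q⁶<X Y²≤X³+X an≤X X≤n⁶
                   (c[1+d]≤m+r⇒c[1+2d]<2m (X ^ 3) main _ d 2remainderBound<X³ X³[1+d]≤main+Rb)))
          where
          X³[1+d]≤main+Rb : X ^ 3 * (1 + d) ≤ main + remainderBound Y K Q a
          X³[1+d]≤main+Rb = ≤-trans
            (+n≡+m+r⇒n≤m+∣r∣ _ main R (trans (ℤ.pos-* (X ^ 3) (suc d)) (trans (cong (ℤ._*_ (+ (X ^ 3))) (sym c≡1+d)) X³c≡main+R)))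
            (+-monoʳ-≤ main ∣R∣≤remainderBound)

    bounded-C-pair : BoundedCPair (+ X) (+ Y)
    bounded-C-pair =
      let M , 1≤M , M⁶<X , X≤[1+M]⁶ = powers-bracket 6 X (≤-trans (≤ᵇ⇒≤ 2 64 _) 64≤X)
      in from-approximation M 1≤M M⁶<X X≤[1+M]⁶ (dirichlet X Y M 1≤M)
      where
      from-approximation : ∀ M → 1 ≤ M → M ^ 6 < X → X ≤ suc M ^ 6 → DirichletApproximation X Y M → BoundedCPair (+ X) (+ Y)
      from-approximation M 1≤M M⁶<X X≤[1+M]⁶ (P , Q , 1≤Q , Q≤M , a[1+M]≤X) =
        P , + Q , P-positive , ℤ.+<+ 1≤Q , C-positive , [c-1]⁶<729Q⁶X (suc M) a[1+M]≤X X≤[1+M]⁶ ,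
        subst (ℤ._< + X) (sym (pos-^ Q 6)) (ℤ.+<+ Q⁶<X) , [P-1]³<X²
        where
        Q⁶<X : Q ^ 6 < X
        Q⁶<X = ≤-<-trans (^-monoˡ-≤ 6 Q≤M) M⁶<X
        2a≤X : 2 * ℤ.∣ P ℤ.* + X ℤ.- + Q ℤ.* + Y ∣ ≤ X
        2a≤X = ≤-trans (≤-trans (≤-reflexive (*-comm 2 ∣u∣)) (*-monoʳ-≤ ∣u∣ (s≤s 1≤M))) a[1+M]≤X
          where
          ∣u∣ : ℕ
          ∣u∣ = ℤ.∣ P ℤ.* + X ℤ.- + Q ℤ.* + Y ∣
        open Approximant P Q 1≤Q Q⁶<X 2a≤X

  IsGoodPair : ℕ → ℕ → Set
  IsGoodPair X Y = (+ X) ℤ.^ 3 ℤ.- (+ Y) ℤ.^ 2 ≢ + 0 × ((+ X) ℤ.^ 3 ℤ.- (+ Y) ℤ.^ 2) ℤ.^ 2 ℤ.< + X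

  small-good-pairs : All (λ X → All (λ Y → IsGoodPair X Y → X ≡ 2 × Y ≡ 3) (upTo 501)) (upTo 64)
  small-good-pairs = toWitness {a? = all? (λ X → all? (λ Y → good? X Y →-dec (X ≟ 2 ×-dec Y ≟ 3)) (upTo 501)) (upTo 64)} _
    where
    good? : ∀ X Y → Dec (IsGoodPair X Y)
    good? X Y = ¬? ((+ X) ℤ.^ 3 ℤ.- (+ Y) ℤ.^ 2 ℤ.≟ + 0) ×-dec (((+ X) ℤ.^ 3 ℤ.- (+ Y) ℤ.^ 2) ℤ.^ 2 ℤ.<? + X)

  bounded-C-pair-2-3 : BoundedCPair (+ 2) (+ 3)
  bounded-C-pair-2-3 = + 1 , + 1 , ℤ.+<+ z<s , ℤ.+<+ z<s , ℤ.+<+ z<s , ℤ.+<+ z<s , ℤ.+<+ (s<s z<s) , ℤ.+<+ z<s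

  small-good-pair : ∀ X Y → X < 64 → Y < 501 → IsGoodPair X Y → X ≡ 2 × Y ≡ 3
  small-good-pair X Y X<64 Y<501 = All.lookup (All.lookup small-good-pairs (∈-upTo⁺ X<64)) (∈-upTo⁺ Y<501)

  bounded-C-pair-small : ∀ X Y k → k ≡ (+ X) ℤ.^ 3 ℤ.- (+ Y) ℤ.^ 2 → k ≢ + 0 → k ℤ.^ 2 ℤ.< + X → X < 64 → BoundedCPair (+ X) (+ Y)
  bounded-C-pair-small X Y k k≡x³-y² k≢0 k²<x X<64 =
    subst₂ (λ X Y → BoundedCPair (+ X) (+ Y)) (sym X≡2) (sym Y≡3) bounded-C-pair-2-3
    where
    open GoodPair X Y k k≡x³-y² k≢0 k²<x using (Y²≤X³+X)
    Y<501 : Y < 501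
    Y<501 = ^-cancelˡ-< 2 (begin-strict
      Y ^ 2       ≤⟨ Y²≤X³+X ⟩
      X ^ 3 + X   <⟨ +-mono-≤-< (^-monoˡ-≤ 3 (s≤s⁻¹ X<64)) X<64 ⟩
      63 ^ 3 + 64 ≤⟨ ≤ᵇ⇒≤ (63 ^ 3 + 64) (501 ^ 2) _ ⟩
      501 ^ 2     ∎)
      where open ≤-Reasoning
    X≡2×Y≡3 : X ≡ 2 × Y ≡ 3
    X≡2×Y≡3 = small-good-pair X Y X<64 Y<501 (subst (λ k → k ≢ + 0 × k ℤ.^ 2 ℤ.< + X) k≡x³-y² (k≢0 , k²<x))
    X≡2 : X ≡ 2
    X≡2 = proj₁ X≡2×Y≡3
    Y≡3 : Y ≡ 3
    Y≡3 = proj₂ X≡2×Y≡3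

  bounded-C-pair : ∀ X Y k → k ≡ (+ X) ℤ.^ 3 ℤ.- (+ Y) ℤ.^ 2 → k ≢ + 0 → k ℤ.^ 2 ℤ.< + X → BoundedCPair (+ X) (+ Y)
  bounded-C-pair X Y k k≡x³-y² k≢0 k²<x =
    [ bounded-C-pair-small X Y k k≡x³-y² k≢0 k²<x , LargeCase.bounded-C-pair X Y k k≡x³-y² k≢0 k²<x ]′ (<-≤-connex X 64)

open import Data.Integer using (ℤ; +_; -[1+_]; _+_; _-_; _*_; _^_; _<_)
open import Data.Product using (_×_; ∃₂; _,_)

proposition5p3 : (x y k : ℤ) → GoodTriplet x y k →
    ∃₂ λ (p q : ℤ) → (+ 0 < p) × (+ 0 < q)
      × (+ 0 < C q p x y)
      × ((C q p x y - + 1) ^ 6 < + 729 * q ^ 6 * x)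
      × (q ^ 6 < x)
      × ((p - + 1) ^ 3 < x ^ 2)
proposition5p3 (+ X)    (+ Y)    k (_ , _ , k≡x³-y² , k≢0 , k²<x) = Construction.bounded-C-pair X Y k k≡x³-y² k≢0 k²<x
proposition5p3 -[1+ _ ] _        _ (() , _)
proposition5p3 (+ _)    -[1+ _ ] _ (_ , () , _)
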